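{- Let $s=s_1s_2s_3\cdots$ be any infinite sequence with each $s_i\in\{\min,\max\}$. Then for $n\ge k\ge1$, the number of permutations $\pi$ of $[n]$ with $m_s(\pi)=k$ equals the signless Stirling number of the first kind $c(n,k)$.
   Context: For $\pi=\pi_1\cdots\pi_n$, define indices $i_1<i_2<\cdots$ by: $\pi_{i_1}=s_1(\pi_1\pi_2\cdots\pi_n)$ (the minimum or maximum of all entries, according to $s_1$), and for $j\ge2$, $\pi_{i_j}=s_j(\pi_{i_{j-1}+1}\pi_{i_{j-1}+2}\cdots\pi_n)$, continuing until $i_k=n$; then $m_s(\pi)=k$. $c(n,k)$ is the number of permutations of $[n]$ with exactly $k$ cycles. -}

module Defs where

open import Data.Bool using (Bool; true; false; if_then_else_; _∧_; not)
open import Data.Nat using (ℕ; zero; suc; _≡ᵇ_; _≤ᵇ_; _⊔_; _⊓_)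
open import Data.Fin using (Fin; toℕ)
open import Data.List using (List; []; _∷_; length; map; concatMap; filterᵇ; foldr; allFin; upTo)
open import Data.Bool.ListAction using (all; any)
open import Data.Vec using (Vec; toList; lookup)
import Data.Vec as V

data MinMax : Set where
  min max : MinMax

-- An infinite sequence s = s_1 s_2 s_3 ..., indexed from 0 (s 0 = s_1).
Seq : Set
Seq = ℕ → MinMax

extreme : MinMax → ℕ → List ℕ → ℕ
extreme min x xs = foldr _⊓_ x xs
extreme max x xs = foldr _⊔_ x xs

after : ℕ → List ℕ → List ℕ
after e [] = []
after e (x ∷ xs) = if x ≡ᵇ e then xs else after e xs

-- number of selected indices i_1 < ... < i_k = n; fuel bounds the number of steps
msFuel : ℕ → Seq → List ℕ → ℕ
msFuel zero s l = 0
msFuel (suc f) s [] = 0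
msFuel (suc f) s (x ∷ xs) with after (extreme (s 0) x xs) (x ∷ xs)
... | [] = 1
... | rest@(_ ∷ _) = suc (msFuel f (λ j → s (suc j)) rest)

-- m_s(π) for a word π (each step strictly shortens the list, so fuel = length suffices)
ms : Seq → List ℕ → ℕ
ms s l = msFuel (length l) s l

-- A permutation of [n] in one-line notation: π_i = lookup π i (values 0..n-1 stand for 1..n)
word : ∀ {n} → Vec (Fin n) n → List ℕ
word π = map toℕ (toList π)

allVecs : (n m : ℕ) → List (Vec (Fin n) m)
allVecs n zero = V.[] ∷ []
allVecs n (suc m) = concatMap (λ x → map (x V.∷_) (allVecs n m)) (allFin n)

distinct : List ℕ → Bool
distinct [] = true
distinct (x ∷ xs) = not (any (λ y → x ≡ᵇ y) xs) ∧ distinct xs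

-- a word of length n over Fin n is a permutation iff its entries are distinct
isPerm : ∀ {n} → Vec (Fin n) n → Bool
isPerm π = distinct (word π)

iter : ∀ {n} → Vec (Fin n) n → ℕ → Fin n → Fin n
iter π zero i = i
iter π (suc j) i = lookup π (iter π j i)

cycleMin : ∀ {n} → Vec (Fin n) n → Fin n → Bool
cycleMin {n} π i = all (λ j → toℕ i ≤ᵇ toℕ (iter π (suc j) i)) (upTo n)

-- number of cycles = number of cycles counted by their minimal elements
cycles : ∀ {n} → Vec (Fin n) n → ℕ
cycles {n} π = length (filterᵇ (cycleMin π) (allFin n))

c : ℕ → ℕ → ℕ
c n k = length (filterᵇ (λ π → isPerm π ∧ (cycles π ≡ᵇ k)) (allVecs n n))

countMs : Seq → ℕ → ℕ → ℕ
countMs s n k = length (filterᵇ (λ π → isPerm π ∧ (ms s (word π) ≡ᵇ k)) (allVecs n n))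

module Submission where

-- Both sides satisfy the recurrence of the signless Stirling numbers of the first kind,
--   S(n+1, k) = S(n, k-1) + n S(n, k),   S(0, 0) = 1,   S(0, k+1) = 0,
-- so they agree for all n and k.
--
-- For m_s we split a permutation π of [n+1] by its first letter x; the rest is an
-- order-preserving relabelling of a permutation σ of [n], and m_s only sees relative order.
-- If x = s_1([n+1]) (0 for min, n for max) it is selected first, then the selection restarts
-- on σ with the shifted sequence s_2 s_3 ...: m_s(π) = 1 + m_{s'}(σ).  For the n other
-- choices of x some later letter beats x, so x is skipped and m_s(π) = m_s(σ).
-- For cycles we split π by its last letter y = π(n): replacing n by y in the word gives σ,
-- and π arises from σ by making n a fixed point (y = n, one more cycle) or by inserting n
-- into the cycle of y (n choices, same number of cycles).

open import Defs
open import Data.Bool using (Bool; true; false; if_then_else_; _∧_; not; T)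
open import Data.Bool.Properties using (∧-assoc; ∧-zeroʳ; ∧-identityʳ; T-≡; ⇔→≡)
open import Data.Nat using (ℕ; zero; suc; _+_; _*_; _∸_; _≡ᵇ_; _≤ᵇ_; _<ᵇ_; _⊔_; _⊓_; _≤_; _<_; z≤n; s≤s; s≤s⁻¹)
open import Data.Nat.Properties
  using (_≟_; _<?_; +-assoc; +-comm; +-identityʳ; ≤-refl; ≤-reflexive; ≤-trans; ≤-<-trans; <-≤-trans; <-trans; <-irrefl; <-cmp;
         <⇒≤; <⇒≱; ≤⇒≯; ≮⇒≥; ≤∧≢⇒<; m≤n⇒m<n∨m≡n; m≤n⇒m≤1+n; m<n⇒m<1+n; n<1+n; m<n⇒0<n∸m; m∸n≤m; m+[n∸m]≡n;
         ≤⇒≤ᵇ; ≤ᵇ⇒≤; m⊓n≤m; m⊓n≤n; m≤m⊔n; m≤n⊔m; m≥n⇒m⊓n≡n; m≤n⇒m⊔n≡n; ⊓-comm; ⊔-comm;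
         mono-≤-distrib-⊓; mono-≤-distrib-⊔; +-commutativeSemigroup; ⊓-commutativeSemigroup; ⊔-commutativeSemigroup;
         +-0-commutativeMonoid)
open import Data.Fin.Relation.Unary.Top using (view; ‵fromℕ; ‵inject₁)
open import Data.Fin using (Fin; toℕ; punchIn; punchOut; inject₁; fromℕ) renaming (zero to fz; suc to fs)
open import Data.Fin.Properties
  using (toℕ-injective; toℕ-inject₁; toℕ-fromℕ; toℕ<n; punchInᵢ≢i; punchIn-injective; punchOut-injective;
         inject₁-injective; fromℕ≢inject₁; injective⇒≤; any?; pigeonhole)
  renaming (_≟_ to _≟ᶠ_; suc-injective to fs-injective)
open import Data.List using (List; []; _∷_; length; map; concatMap; filterᵇ; foldr; upTo; tabulate; _++_)
open import Data.List.Properties using (length-map)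
open import Data.List.Membership.Propositional.Properties using (∈-upTo⁺)
open import Data.Bool.ListAction using (any)
open import Data.List.Relation.Unary.All using (All; []; _∷_)
import Data.List.Relation.Unary.All as All
import Data.List.Relation.Unary.All.Properties as All
open import Data.List.Relation.Unary.Any using (Any; here; there)
import Data.List.Relation.Unary.Any as Any
import Data.List.Relation.Unary.Any.Properties as Any
open import Data.Vec using (Vec; toList; lookup; _∷ʳ_)
import Data.Vec as V
open import Data.Vec.Properties using (lookup-map)
open import Data.Product using (_×_; _,_; ∃; proj₁; proj₂)
open import Data.Sum using (_⊎_; inj₁; inj₂)
open import Data.Empty using (⊥-elim)
open import Function using (_∘_; flip)
open import Function.Definitions using (Injective)
open import Function.Bundles using (mk⇔; Equivalence)
open import Relation.Nullary using (yes; no)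
open import Relation.Binary.Definitions using (tri<; tri≈; tri>)
open import Relation.Nullary.Decidable using (dec-true; dec-false)
open import Relation.Binary.PropositionalEquality
open import Algebra.Properties.CommutativeSemigroup +-commutativeSemigroup using (x∙yz≈y∙xz)
open import Algebra.Properties.CommutativeSemigroup ⊓-commutativeSemigroup using () renaming (x∙yz≈y∙xz to ⊓-left-comm)
open import Algebra.Properties.CommutativeSemigroup ⊔-commutativeSemigroup using () renaming (x∙yz≈y∙xz to ⊔-left-comm)
open import Algebra.Properties.CommutativeMonoid.Sum +-0-commutativeMonoid
  using (sum; sum-cong-≗; ∑-comm; sum-remove; sum-init-last)

𝟙 : Bool → ℕ
𝟙 true = 1
𝟙 false = 0

count : {A : Set} → (A → Bool) → List A → ℕ
count P xs = length (filterᵇ P xs)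

count-∷ : {A : Set} (P : A → Bool) (x : A) (xs : List A) → count P (x ∷ xs) ≡ 𝟙 (P x) + count P xs
count-∷ P x xs with P x
... | true = refl
... | false = refl

count-++ : {A : Set} (P : A → Bool) (xs ys : List A) → count P (xs ++ ys) ≡ count P xs + count P ys
count-++ P [] ys = refl
count-++ P (x ∷ xs) ys = begin
  count P (x ∷ xs ++ ys)             ≡⟨ count-∷ P x (xs ++ ys) ⟩
  𝟙 (P x) + count P (xs ++ ys)       ≡⟨ cong (𝟙 (P x) +_) (count-++ P xs ys) ⟩
  𝟙 (P x) + (count P xs + count P ys) ≡⟨ +-assoc (𝟙 (P x)) _ _ ⟨
  𝟙 (P x) + count P xs + count P ys  ≡⟨ cong (_+ count P ys) (count-∷ P x xs) ⟨
  count P (x ∷ xs) + count P ys      ∎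
  where open ≡-Reasoning

count-map : {A B : Set} (P : B → Bool) (g : A → B) (xs : List A) → count P (map g xs) ≡ count (P ∘ g) xs
count-map P g [] = refl
count-map P g (x ∷ xs) with P (g x)
... | true = cong suc (count-map P g xs)
... | false = count-map P g xs

count-cong : {A : Set} {P Q : A → Bool} → (∀ a → P a ≡ Q a) → (xs : List A) → count P xs ≡ count Q xs
count-cong e [] = refl
count-cong {P = P} {Q} e (x ∷ xs) = begin
  count P (x ∷ xs)          ≡⟨ count-∷ P x xs ⟩
  𝟙 (P x) + count P xs      ≡⟨ cong₂ _+_ (cong 𝟙 (e x)) (count-cong e xs) ⟩
  𝟙 (Q x) + count Q xs      ≡⟨ count-∷ Q x xs ⟨
  count Q (x ∷ xs)          ∎
  where open ≡-Reasoning

count-none : {A : Set} (xs : List A) → count (λ _ → false) xs ≡ 0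
count-none [] = refl
count-none (x ∷ xs) = count-none xs

count-tabulate : {A : Set} (P : A → Bool) (n : ℕ) (g : Fin n → A) → count P (tabulate g) ≡ sum (𝟙 ∘ P ∘ g)
count-tabulate P zero g = refl
count-tabulate P (suc n) g = trans (count-∷ P (g fz) _) (cong (𝟙 (P (g fz)) +_) (count-tabulate P n (g ∘ fs)))

count-concatMap : {A B : Set} (P : B → Bool) (n : ℕ) (g : Fin n → A) (f : A → List B) →
                  count P (concatMap f (tabulate g)) ≡ sum (λ i → count P (f (g i)))
count-concatMap P zero g f = refl
count-concatMap P (suc n) g f =
  trans (count-++ P (f (g fz)) _) (cong (count P (f (g fz)) +_) (count-concatMap P n (g ∘ fs) f))

sum-const : ∀ n B → sum {n} (λ _ → B) ≡ n * B
sum-const zero B = refl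
sum-const (suc n) B = cong (B +_) (sum-const n B)

sum-except : ∀ n (e : Fin (suc n)) (f : Fin (suc n) → ℕ) B → (∀ y → y ≢ e → f y ≡ B) → sum f ≡ f e + n * B
sum-except n e f B others = begin
  sum f                          ≡⟨ sum-remove f ⟩
  f e + sum (f ∘ punchIn e)      ≡⟨ cong (f e +_) (sum-cong-≗ (λ z → others (punchIn e z) (punchInᵢ≢i e z))) ⟩
  f e + sum {n} (λ _ → B)        ≡⟨ cong (f e +_) (sum-const n B) ⟩
  f e + n * B                    ∎
  where open ≡-Reasoning

letters : ∀ {n m} → Vec (Fin n) m → List ℕ
letters w = map toℕ (toList w)

countWords : ∀ n m → (Vec (Fin n) m → Bool) → ℕ
countWords n m P = count P (allVecs n m)

countWords-cong : ∀ n m {P Q : Vec (Fin n) m → Bool} → (∀ w → P w ≡ Q w) → countWords n m P ≡ countWords n m Q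
countWords-cong n m e = count-cong e (allVecs n m)

countWords-none : ∀ n m → countWords n m (λ _ → false) ≡ 0
countWords-none n m = count-none (allVecs n m)

countWords-[] : ∀ n (Q : Vec (Fin n) zero → Bool) → countWords n zero Q ≡ 𝟙 (Q V.[])
countWords-[] n Q = trans (count-∷ Q V.[] []) (+-identityʳ _)

countWords-∷ : ∀ n m (P : Vec (Fin n) (suc m) → Bool) →
               countWords n (suc m) P ≡ sum (λ x → countWords n m (λ w → P (x V.∷ w)))
countWords-∷ n m P =
  trans (count-concatMap P n (λ x → x) _) (sum-cong-≗ (λ x → count-map P (x V.∷_) (allVecs n m)))

countWords-∷ʳ : ∀ n m (P : Vec (Fin n) (suc m) → Bool) →
                countWords n (suc m) P ≡ sum (λ y → countWords n m (λ w → P (w ∷ʳ y)))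
countWords-∷ʳ n zero P = trans (countWords-∷ n zero P)
  (sum-cong-≗ (λ y → trans (countWords-[] n (λ w → P (y V.∷ w))) (sym (countWords-[] n (λ w → P (w ∷ʳ y))))))
countWords-∷ʳ n (suc m) P = begin
  countWords n (suc (suc m)) P
    ≡⟨ countWords-∷ n (suc m) P ⟩
  sum (λ x → countWords n (suc m) (λ w → P (x V.∷ w)))
    ≡⟨ sum-cong-≗ (λ x → countWords-∷ʳ n m (λ w → P (x V.∷ w))) ⟩
  sum (λ x → sum (λ y → countWords n m (λ w → P (x V.∷ (w ∷ʳ y)))))
    ≡⟨ ∑-comm (λ x y → countWords n m (λ w → P (x V.∷ (w ∷ʳ y)))) ⟩
  sum (λ y → sum (λ x → countWords n m (λ w → P (x V.∷ (w ∷ʳ y)))))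
    ≡⟨ sum-cong-≗ (λ y → countWords-∷ n m (λ v → P (v ∷ʳ y))) ⟨
  sum (λ y → countWords n (suc m) (λ v → P (v ∷ʳ y)))
    ∎
  where open ≡-Reasoning

fresh : ℕ → List ℕ → Bool
fresh a [] = true
fresh a (x ∷ xs) = not (a ≡ᵇ x) ∧ fresh a xs

record Enumerates {n} (h : Fin n → Fin (suc n)) (x : Fin (suc n)) : Set where
  field
    misses : ∀ z → h z ≢ x
    injective : Injective _≡_ _≡_ h
    sum-split : ∀ f → sum f ≡ f x + sum (f ∘ h)

countWords-avoiding : ∀ {n} {x : Fin (suc n)} {h : Fin n → Fin (suc n)} → Enumerates h x →
                      ∀ m (R : Vec (Fin (suc n)) m → Bool) →
                      countWords (suc n) m (λ w → fresh (toℕ x) (letters w) ∧ R w) ≡ countWords n m (λ σ → R (V.map h σ))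
countWords-avoiding {n} {x} {h} enum zero R =
  trans (countWords-[] (suc n) (λ w → fresh (toℕ x) (letters w) ∧ R w)) (sym (countWords-[] n (λ σ → R (V.map h σ))))
countWords-avoiding {n} {x} {h} enum (suc m) R = begin
  countWords (suc n) (suc m) (λ w → fresh (toℕ x) (letters w) ∧ R w)
    ≡⟨ countWords-∷ (suc n) m _ ⟩
  sum f
    ≡⟨ Enumerates.sum-split enum f ⟩
  f x + sum (f ∘ h)
    ≡⟨ cong (_+ sum (f ∘ h)) f-at-x ⟩
  sum (f ∘ h)
    ≡⟨ sum-cong-≗ f-along-h ⟩
  sum (λ z → countWords n m (λ σ → R (V.map h (z V.∷ σ))))
    ≡⟨ countWords-∷ n m _ ⟨
  countWords n (suc m) (λ σ → R (V.map h σ))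
    ∎
  where
  open ≡-Reasoning
  f : Fin (suc n) → ℕ
  f y = countWords (suc n) m (λ w → fresh (toℕ x) (toℕ y ∷ letters w) ∧ R (y V.∷ w))
  -- no word starting with x avoids x
  f-at-x : f x ≡ 0
  f-at-x = trans (countWords-cong (suc n) m (λ w → cong (λ b → (not b ∧ fresh (toℕ x) (letters w)) ∧ R (x V.∷ w)) (dec-true (toℕ x ≟ toℕ x) refl)))
                 (countWords-none (suc n) m)
  f-along-h : ∀ z → f (h z) ≡ countWords n m (λ σ → R (V.map h (z V.∷ σ)))
  f-along-h z =
    trans (countWords-cong (suc n) m (λ w → cong (λ b → (not b ∧ fresh (toℕ x) (letters w)) ∧ R (h z V.∷ w))
            (dec-false (toℕ x ≟ toℕ (h z)) (λ e → Enumerates.misses enum z (sym (toℕ-injective e))))))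
          (countWords-avoiding enum m (λ w → R (h z V.∷ w)))

distinct-∷ : ∀ a l → distinct (a ∷ l) ≡ fresh a l ∧ distinct l
distinct-∷ a l = cong (_∧ distinct l) (not-any a l)
  where
  not-any : ∀ a l → not (any (a ≡ᵇ_) l) ≡ fresh a l
  not-any a [] = refl
  not-any a (x ∷ xs) with a ≡ᵇ x
  ... | true = refl
  ... | false = not-any a xs

fresh-snoc : ∀ a l b → fresh a (l ++ b ∷ []) ≡ fresh a l ∧ not (a ≡ᵇ b)
fresh-snoc a [] b = ∧-identityʳ _
fresh-snoc a (x ∷ l) b = trans (cong (not (a ≡ᵇ x) ∧_) (fresh-snoc a l b)) (sym (∧-assoc (not (a ≡ᵇ x)) _ _))

distinct-snoc : ∀ l a → distinct (l ++ a ∷ []) ≡ fresh a l ∧ distinct l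
distinct-snoc [] a = refl
distinct-snoc (x ∷ l) a = begin
  distinct (x ∷ l ++ a ∷ [])                             ≡⟨ distinct-∷ x (l ++ a ∷ []) ⟩
  fresh x (l ++ a ∷ []) ∧ distinct (l ++ a ∷ [])         ≡⟨ cong₂ _∧_ (fresh-snoc x l a) (distinct-snoc l a) ⟩
  (fresh x l ∧ not (x ≡ᵇ a)) ∧ (fresh a l ∧ distinct l)   ≡⟨ regroup (fresh x l) (x ≡ᵇ a) (fresh a l) (distinct l) ⟩
  (not (x ≡ᵇ a) ∧ fresh a l) ∧ (fresh x l ∧ distinct l)   ≡⟨ cong (λ b → (not b ∧ fresh a l) ∧ (fresh x l ∧ distinct l)) (≡ᵇ-sym x a) ⟩
  (not (a ≡ᵇ x) ∧ fresh a l) ∧ (fresh x l ∧ distinct l)   ≡⟨ cong ((not (a ≡ᵇ x) ∧ fresh a l) ∧_) (distinct-∷ x l) ⟨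
  fresh a (x ∷ l) ∧ distinct (x ∷ l)                     ∎
  where
  open ≡-Reasoning
  ≡ᵇ-sym : ∀ m n → (m ≡ᵇ n) ≡ (n ≡ᵇ m)
  ≡ᵇ-sym zero zero = refl
  ≡ᵇ-sym zero (suc n) = refl
  ≡ᵇ-sym (suc m) zero = refl
  ≡ᵇ-sym (suc m) (suc n) = ≡ᵇ-sym m n
  regroup : ∀ p q r t → (p ∧ not q) ∧ (r ∧ t) ≡ (not q ∧ r) ∧ (p ∧ t)
  regroup true  true  r     t = refl
  regroup true  false true  t = refl
  regroup true  false false t = refl
  regroup false true  r     t = refl
  regroup false false true  t = refl
  regroup false false false t = refl

letters-∷ʳ : ∀ {n m} (w : Vec (Fin n) m) y → letters (w ∷ʳ y) ≡ letters w ++ toℕ y ∷ []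
letters-∷ʳ V.[] y = refl
letters-∷ʳ (x V.∷ w) y = cong (toℕ x ∷_) (letters-∷ʳ w y)

letters-map : ∀ {n k m} (h : Fin n → Fin k) (g : ℕ → ℕ) → (∀ z → toℕ (h z) ≡ g (toℕ z)) →
              (σ : Vec (Fin n) m) → letters (V.map h σ) ≡ map g (letters σ)
letters-map h g e V.[] = refl
letters-map h g e (x V.∷ σ) = cong₂ _∷_ (e x) (letters-map h g e σ)

distinct-map : ∀ {n k m} (h : Fin n → Fin k) → Injective _≡_ _≡_ h → (σ : Vec (Fin n) m) →
               distinct (letters (V.map h σ)) ≡ distinct (letters σ)
distinct-map h h-inj V.[] = refl
distinct-map h h-inj (x V.∷ σ) = begin
  distinct (letters (V.map h (x V.∷ σ)))                           ≡⟨ distinct-∷ (toℕ (h x)) (letters (V.map h σ)) ⟩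
  fresh (toℕ (h x)) (letters (V.map h σ)) ∧ distinct (letters (V.map h σ))
    ≡⟨ cong₂ _∧_ (fresh-map σ) (distinct-map h h-inj σ) ⟩
  fresh (toℕ x) (letters σ) ∧ distinct (letters σ)                 ≡⟨ distinct-∷ (toℕ x) (letters σ) ⟨
  distinct (letters (x V.∷ σ))                                     ∎
  where
  open ≡-Reasoning
  same-test : ∀ y → (toℕ (h x) ≡ᵇ toℕ (h y)) ≡ (toℕ x ≡ᵇ toℕ y)
  same-test y with x ≟ᶠ y
  ... | yes refl = trans (dec-true (toℕ (h x) ≟ toℕ (h x)) refl) (sym (dec-true (toℕ x ≟ toℕ x) refl))
  ... | no x≢y = trans (dec-false (toℕ (h x) ≟ toℕ (h y)) (x≢y ∘ h-inj ∘ toℕ-injective))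
                       (sym (dec-false (toℕ x ≟ toℕ y) (x≢y ∘ toℕ-injective)))
  fresh-map : ∀ {m} (τ : Vec _ m) → fresh (toℕ (h x)) (letters (V.map h τ)) ≡ fresh (toℕ x) (letters τ)
  fresh-map V.[] = refl
  fresh-map (y V.∷ τ) = cong₂ (λ b c → not b ∧ c) (same-test y) (fresh-map τ)

fresh-map-missed : ∀ {n k m} (h : Fin n → Fin k) (x : Fin k) → (∀ z → h z ≢ x) → (σ : Vec (Fin n) m) →
                   fresh (toℕ x) (letters (V.map h σ)) ≡ true
fresh-map-missed h x misses V.[] = refl
fresh-map-missed h x misses (z V.∷ σ)
  rewrite dec-false (toℕ x ≟ toℕ (h z)) (λ e → misses z (sym (toℕ-injective e))) = fresh-map-missed h x misses σ

∧-true⁻ : ∀ {a b} → a ∧ b ≡ true → a ≡ true × b ≡ true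
∧-true⁻ {true} {true} refl = refl , refl

distinct-∷⁻ : ∀ {n m} (x : Fin n) (σ : Vec (Fin n) m) → distinct (letters (x V.∷ σ)) ≡ true →
              fresh (toℕ x) (letters σ) ≡ true × distinct (letters σ) ≡ true
distinct-∷⁻ x σ d = ∧-true⁻ (trans (sym (distinct-∷ (toℕ x) (letters σ))) d)

fresh-lookup : ∀ {n m} (a : Fin n) (σ : Vec (Fin n) m) → fresh (toℕ a) (letters σ) ≡ true → ∀ j → lookup σ j ≢ a
fresh-lookup a (x V.∷ σ) f fz refl with proj₁ (∧-true⁻ {not (toℕ x ≡ᵇ toℕ x)} f)
... | e rewrite dec-true (toℕ x ≟ toℕ x) refl with e
... | ()
fresh-lookup a (x V.∷ σ) f (fs j) = fresh-lookup a σ (proj₂ (∧-true⁻ {not (toℕ a ≡ᵇ toℕ x)} f)) j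

lookup-injective : ∀ {n m} (σ : Vec (Fin n) m) → distinct (letters σ) ≡ true → Injective _≡_ _≡_ (lookup σ)
lookup-injective (x V.∷ σ) d {fz} {fz} e = refl
lookup-injective (x V.∷ σ) d {fz} {fs j} e = ⊥-elim (fresh-lookup x σ (proj₁ (distinct-∷⁻ x σ d)) j (sym e))
lookup-injective (x V.∷ σ) d {fs i} {fz} e = ⊥-elim (fresh-lookup x σ (proj₁ (distinct-∷⁻ x σ d)) i e)
lookup-injective (x V.∷ σ) d {fs i} {fs j} e = cong fs (lookup-injective σ (proj₂ (distinct-∷⁻ x σ d)) e)

injective⇒surjective : ∀ {n} (f : Fin n → Fin n) → Injective _≡_ _≡_ f → ∀ v → ∃ λ i → f i ≡ v
injective⇒surjective f f-inj v with any? (λ i → f i ≟ᶠ v)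
... | yes hit = hit
injective⇒surjective {suc m} f f-inj v | no miss = ⊥-elim (<-irrefl refl (injective⇒≤ squeezed-injective))
  where
  squeezed : Fin (suc m) → Fin m
  squeezed i = punchOut {i = v} {j = f i} (λ e → miss (i , sym e))
  squeezed-injective : Injective _≡_ _≡_ squeezed
  squeezed-injective {i} {j} = f-inj ∘ punchOut-injective (λ e → miss (i , sym e)) (λ e → miss (j , sym e))

occurs : ∀ {n} (σ : Vec (Fin n) n) → distinct (letters σ) ≡ true → ∀ v → Any (_≡ toℕ v) (letters σ)
occurs σ d v with injective⇒surjective (lookup σ) (lookup-injective σ d) v
... | i , refl = at σ i
  where
  at : ∀ {n m} (σ : Vec (Fin n) m) i → Any (_≡ toℕ (lookup σ i)) (letters σ)
  at (x V.∷ σ) fz = here refl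
  at (x V.∷ σ) (fs i) = there (at σ i)

letters-bounded : ∀ {n m} (σ : Vec (Fin n) m) → All (_< n) (letters σ)
letters-bounded V.[] = []
letters-bounded (x V.∷ σ) = toℕ<n x ∷ letters-bounded σ

punchIn-enumerates : ∀ {n} (x : Fin (suc n)) → Enumerates (punchIn x) x
punchIn-enumerates x = record
  { misses = punchInᵢ≢i x
  ; injective = punchIn-injective x _ _
  ; sum-split = λ f → sum-remove f
  }

perms-without : ∀ {n} {x : Fin (suc n)} {h : Fin n → Fin (suc n)} → Enumerates h x → (R : Vec (Fin (suc n)) n → Bool) →
                countWords (suc n) n (λ w → fresh (toℕ x) (letters w) ∧ (distinct (letters w) ∧ R w))
                  ≡ countWords n n (λ σ → isPerm σ ∧ R (V.map h σ))
perms-without {n} {h = h} enum R =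
  trans (countWords-avoiding enum n (λ w → distinct (letters w) ∧ R w))
        (countWords-cong n n (λ σ → cong (_∧ R (V.map h σ)) (distinct-map h (Enumerates.injective enum) σ)))

perms-first-letter : ∀ {n} (x : Fin (suc n)) (P : Vec (Fin (suc n)) (suc n) → Bool) →
                     countWords (suc n) n (λ w → isPerm (x V.∷ w) ∧ P (x V.∷ w))
                       ≡ countWords n n (λ σ → isPerm σ ∧ P (x V.∷ V.map (punchIn x) σ))
perms-first-letter {n} x P =
  trans (countWords-cong (suc n) n (λ w → trans (cong (_∧ P (x V.∷ w)) (distinct-∷ (toℕ x) (letters w)))
                                                (∧-assoc (fresh (toℕ x) (letters w)) _ _)))
        (perms-without (punchIn-enumerates x) (λ w → P (x V.∷ w)))

perms-last-letter : ∀ {n} {y : Fin (suc n)} {h : Fin n → Fin (suc n)} → Enumerates h y → (P : Vec (Fin (suc n)) (suc n) → Bool) →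
                    countWords (suc n) n (λ w → isPerm (w ∷ʳ y) ∧ P (w ∷ʳ y))
                      ≡ countWords n n (λ σ → isPerm σ ∧ P (V.map h σ ∷ʳ y))
perms-last-letter {n} {y} enum P =
  trans (countWords-cong (suc n) n (λ w → trans (cong (_∧ P (w ∷ʳ y)) (trans (cong distinct (letters-∷ʳ w y)) (distinct-snoc (letters w) (toℕ y))))
                                                (∧-assoc (fresh (toℕ y) (letters w)) _ _)))
        (perms-without enum (λ w → P (w ∷ʳ y)))

∧-cong-if : ∀ {d a b : Bool} → (d ≡ true → a ≡ b) → d ∧ a ≡ d ∧ b
∧-cong-if {true} a≡b = a≡b refl
∧-cong-if {false} _ = refl

stirling : ℕ → ℕ → ℕ
stirling zero zero = 1
stirling zero (suc k) = 0
stirling (suc n) zero = n * stirling n zero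
stirling (suc n) (suc k) = stirling n k + n * stirling n (suc k)

perms-suc≡0 : ∀ n (f : Vec (Fin n) n → ℕ) → countWords n n (λ σ → isPerm σ ∧ (suc (f σ) ≡ᵇ 0)) ≡ 0
perms-suc≡0 n f = trans (countWords-cong n n (λ σ → ∧-zeroʳ (isPerm σ))) (countWords-none n n)

-- The selection process defining m_s.

shift : Seq → Seq
shift s j = s (suc j)

-- The value of msFuel (suc f) given the suffix r following the first selected entry.
continue : ℕ → Seq → List ℕ → ℕ
continue f s [] = 1
continue f s (x ∷ xs) = suc (msFuel f (shift s) (x ∷ xs))

msFuel-unfold : ∀ f s x xs → msFuel (suc f) s (x ∷ xs) ≡ continue f s (after (extreme (s 0) x xs) (x ∷ xs))
msFuel-unfold f s x xs with after (extreme (s 0) x xs) (x ∷ xs)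
... | [] = refl
... | y ∷ ys = refl

after-length : ∀ e x xs → length (after e (x ∷ xs)) ≤ length xs
after-length e x xs with x ≡ᵇ e
... | true = ≤-refl
after-length e x [] | false = z≤n
after-length e x (y ∷ ys) | false = m≤n⇒m≤1+n (after-length e y ys)

msFuel-fuel : ∀ f g s l → length l ≤ f → length l ≤ g → msFuel f s l ≡ msFuel g s l
continue-fuel : ∀ f g s r → length r ≤ f → length r ≤ g → continue f s r ≡ continue g s r
msFuel-fuel zero zero s [] _ _ = refl
msFuel-fuel zero (suc g) s [] _ _ = refl
msFuel-fuel (suc f) zero s [] _ _ = refl
msFuel-fuel (suc f) (suc g) s [] _ _ = refl
msFuel-fuel (suc f) (suc g) s (x ∷ xs) (s≤s p) (s≤s q) = begin
  msFuel (suc f) s (x ∷ xs)   ≡⟨ msFuel-unfold f s x xs ⟩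
  continue f s r              ≡⟨ continue-fuel f g s r (≤-trans (after-length _ x xs) p) (≤-trans (after-length _ x xs) q) ⟩
  continue g s r              ≡⟨ msFuel-unfold g s x xs ⟨
  msFuel (suc g) s (x ∷ xs)   ∎
  where
  open ≡-Reasoning
  r = after (extreme (s 0) x xs) (x ∷ xs)
continue-fuel f g s [] p q = refl
continue-fuel f g s (x ∷ xs) p q = cong suc (msFuel-fuel f g (shift s) (x ∷ xs) p q)

ms-unfold : ∀ s x xs → ms s (x ∷ xs) ≡ continue (length xs) s (after (extreme (s 0) x xs) (x ∷ xs))
ms-unfold s x xs = msFuel-unfold (length xs) s x xs

continue-length : ∀ s xs → continue (length xs) s xs ≡ suc (ms (shift s) xs)
continue-length s [] = refl
continue-length s (x ∷ xs) = refl

Beats : MinMax → ℕ → ℕ → Set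
Beats min a b = a < b
Beats max a b = b < a

foldr-seed : (_∙_ : ℕ → ℕ → ℕ) → (∀ a b → a ∙ b ≡ b ∙ a) → (∀ a b c → a ∙ (b ∙ c) ≡ b ∙ (a ∙ c)) →
             ∀ a y ys → foldr _∙_ a (y ∷ ys) ≡ a ∙ foldr _∙_ y ys
foldr-seed _∙_ comm left-comm a y ys = begin
  y ∙ foldr _∙_ a ys     ≡⟨ pull y a ys ⟨
  foldr _∙_ (y ∙ a) ys   ≡⟨ cong (λ u → foldr _∙_ u ys) (comm y a) ⟩
  foldr _∙_ (a ∙ y) ys   ≡⟨ pull a y ys ⟩
  a ∙ foldr _∙_ y ys     ∎
  where
  open ≡-Reasoning
  pull : ∀ a b ys → foldr _∙_ (a ∙ b) ys ≡ a ∙ foldr _∙_ b ys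
  pull a b [] = refl
  pull a b (z ∷ zs) = trans (cong (z ∙_) (pull a b zs)) (left-comm z a _)

extreme-seed : ∀ m a xs → All (Beats m a) xs → extreme m a xs ≡ a
extreme-seed min a [] [] = refl
extreme-seed max a [] [] = refl
extreme-seed min a (y ∷ ys) (p ∷ ps) = trans (cong (y ⊓_) (extreme-seed min a ys ps)) (m≥n⇒m⊓n≡n (<⇒≤ p))
extreme-seed max a (y ∷ ys) (p ∷ ps) = trans (cong (y ⊔_) (extreme-seed max a ys ps)) (m≤n⇒m⊔n≡n (<⇒≤ p))

extreme-beats : ∀ m {a} y ys → Any (λ b → Beats m b a) (y ∷ ys) → Beats m (extreme m y ys) a
extreme-beats min y [] (here p) = p
extreme-beats min y (z ∷ zs) (here p) = ≤-<-trans (m⊓n≤n z _) (extreme-beats min y zs (here p))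
extreme-beats min y (z ∷ zs) (there (here q)) = ≤-<-trans (m⊓n≤m z _) q
extreme-beats min y (z ∷ zs) (there (there r)) = ≤-<-trans (m⊓n≤n z _) (extreme-beats min y zs (there r))
extreme-beats max y [] (here p) = p
extreme-beats max y (z ∷ zs) (here p) = <-≤-trans (extreme-beats max y zs (here p)) (m≤n⊔m z _)
extreme-beats max y (z ∷ zs) (there (here q)) = <-≤-trans q (m≤m⊔n z _)
extreme-beats max y (z ∷ zs) (there (there r)) = <-≤-trans (extreme-beats max y zs (there r)) (m≤n⊔m z _)

extreme-beaten-seed : ∀ m a y ys → Beats m (extreme m y ys) a → extreme m a (y ∷ ys) ≡ extreme m y ys
extreme-beaten-seed min a y ys lt = trans (foldr-seed _⊓_ ⊓-comm ⊓-left-comm a y ys) (m≥n⇒m⊓n≡n (<⇒≤ lt))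
extreme-beaten-seed max a y ys lt = trans (foldr-seed _⊔_ ⊔-comm ⊔-left-comm a y ys) (m≤n⇒m⊔n≡n (<⇒≤ lt))

Beats-irrefl : ∀ m {a b} → Beats m a b → a ≢ b
Beats-irrefl min lt refl = <-irrefl refl lt
Beats-irrefl max lt refl = <-irrefl refl lt

after-head : ∀ a xs → after a (a ∷ xs) ≡ xs
after-head a xs = cong (λ b → if b then xs else after a xs) (dec-true (a ≟ a) refl)

after-other : ∀ e a xs → a ≢ e → after e (a ∷ xs) ≡ after e xs
after-other e a xs a≢e = cong (λ b → if b then xs else after e xs) (dec-false (a ≟ e) a≢e)

ms-head-selected : ∀ s a xs → All (Beats (s 0) a) xs → ms s (a ∷ xs) ≡ suc (ms (shift s) xs)
ms-head-selected s a xs wins = begin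
  ms s (a ∷ xs)                                                    ≡⟨ ms-unfold s a xs ⟩
  continue (length xs) s (after (extreme (s 0) a xs) (a ∷ xs))     ≡⟨ cong (λ e → continue (length xs) s (after e (a ∷ xs))) (extreme-seed (s 0) a xs wins) ⟩
  continue (length xs) s (after a (a ∷ xs))                        ≡⟨ cong (continue (length xs) s) (after-head a xs) ⟩
  continue (length xs) s xs                                        ≡⟨ continue-length s xs ⟩
  suc (ms (shift s) xs)                                            ∎
  where open ≡-Reasoning

ms-head-skipped : ∀ s a xs → Any (λ b → Beats (s 0) b a) xs → ms s (a ∷ xs) ≡ ms s xs
ms-head-skipped s a (y ∷ ys) beaten = begin
  ms s (a ∷ y ∷ ys)                                ≡⟨ ms-unfold s a (y ∷ ys) ⟩
  continue L s (after (extreme (s 0) a (y ∷ ys)) (a ∷ y ∷ ys)) ≡⟨ cong (λ e → continue L s (after e (a ∷ y ∷ ys))) (extreme-beaten-seed (s 0) a y ys lt) ⟩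
  continue L s (after E (a ∷ y ∷ ys))              ≡⟨ cong (continue L s) (after-other E a (y ∷ ys) (Beats-irrefl (s 0) lt ∘ sym)) ⟩
  continue L s (after E (y ∷ ys))                  ≡⟨ continue-fuel L (length ys) s _ (m≤n⇒m≤1+n (after-length E y ys)) (after-length E y ys) ⟩
  continue (length ys) s (after E (y ∷ ys))        ≡⟨ ms-unfold s y ys ⟨
  ms s (y ∷ ys)                                    ∎
  where
  open ≡-Reasoning
  L = suc (length ys)
  E = extreme (s 0) y ys
  lt : Beats (s 0) E a
  lt = extreme-beats (s 0) y ys beaten

module Relabel (f : ℕ → ℕ) (f-mono : ∀ {a b} → a < b → f a < f b) where

  f-mono-≤ : ∀ {a b} → a ≤ b → f a ≤ f b
  f-mono-≤ a≤b with m≤n⇒m<n∨m≡n a≤b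
  ... | inj₁ a<b = <⇒≤ (f-mono a<b)
  ... | inj₂ refl = ≤-refl

  f-injective : ∀ {a b} → f a ≡ f b → a ≡ b
  f-injective {a} {b} e with <-cmp a b
  ... | tri< a<b _ _ = ⊥-elim (<-irrefl e (f-mono a<b))
  ... | tri≈ _ a≡b _ = a≡b
  ... | tri> _ _ b<a = ⊥-elim (<-irrefl (sym e) (f-mono b<a))

  extreme-map : ∀ m x xs → extreme m (f x) (map f xs) ≡ f (extreme m x xs)
  extreme-map m x [] = extreme-[] m
    where
    extreme-[] : ∀ m → extreme m (f x) [] ≡ f (extreme m x [])
    extreme-[] min = refl
    extreme-[] max = refl
  extreme-map min x (y ∷ ys) =
    trans (cong (f y ⊓_) (extreme-map min x ys)) (sym (mono-≤-distrib-⊓ f-mono-≤ y _))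
  extreme-map max x (y ∷ ys) =
    trans (cong (f y ⊔_) (extreme-map max x ys)) (sym (mono-≤-distrib-⊔ f-mono-≤ y _))

  after-map : ∀ e l → after (f e) (map f l) ≡ map f (after e l)
  after-map e [] = refl
  after-map e (x ∷ xs) with x ≟ e
  ... | yes refl rewrite dec-true (f x ≟ f x) refl | dec-true (x ≟ x) refl = refl
  ... | no x≢e rewrite dec-false (f x ≟ f e) (x≢e ∘ f-injective) | dec-false (x ≟ e) x≢e = after-map e xs

  msFuel-map : ∀ F s l → msFuel F s (map f l) ≡ msFuel F s l
  continue-map : ∀ F s r → continue F s (map f r) ≡ continue F s r
  msFuel-map zero s l = refl
  msFuel-map (suc F) s [] = refl
  msFuel-map (suc F) s (x ∷ xs) = begin
    msFuel (suc F) s (f x ∷ map f xs)                                      ≡⟨ msFuel-unfold F s (f x) (map f xs) ⟩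
    continue F s (after (extreme (s 0) (f x) (map f xs)) (map f (x ∷ xs))) ≡⟨ cong (λ e → continue F s (after e (map f (x ∷ xs)))) (extreme-map (s 0) x xs) ⟩
    continue F s (after (f (extreme (s 0) x xs)) (map f (x ∷ xs)))         ≡⟨ cong (continue F s) (after-map _ (x ∷ xs)) ⟩
    continue F s (map f (after (extreme (s 0) x xs) (x ∷ xs)))             ≡⟨ continue-map F s _ ⟩
    continue F s (after (extreme (s 0) x xs) (x ∷ xs))                     ≡⟨ msFuel-unfold F s x xs ⟨
    msFuel (suc F) s (x ∷ xs)                                              ∎
    where open ≡-Reasoning
  continue-map F s [] = refl
  continue-map F s (x ∷ xs) = cong suc (msFuel-map F (shift s) (x ∷ xs))

  ms-map : ∀ s l → ms s (map f l) ≡ ms s l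
  ms-map s l rewrite length-map f l = msFuel-map (length l) s l

-- Recurrence for the number of permutations with a given value of m_s.

punchInℕ : ℕ → ℕ → ℕ
punchInℕ x v = if v <ᵇ x then v else suc v

punchInℕ-below : ∀ {x v} → v < x → punchInℕ x v ≡ v
punchInℕ-below {x} {v} v<x rewrite dec-true (v <? x) v<x = refl

punchInℕ-above : ∀ {x v} → x ≤ v → punchInℕ x v ≡ suc v
punchInℕ-above {x} {v} x≤v rewrite dec-false (v <? x) (≤⇒≯ x≤v) = refl

punchInℕ-mono : ∀ x {a b} → a < b → punchInℕ x a < punchInℕ x b
punchInℕ-mono x {a} {b} a<b with a <? x | b <? x
... | yes a<x | yes b<x rewrite punchInℕ-below a<x | punchInℕ-below b<x = a<b
... | yes a<x | no b≮x rewrite punchInℕ-below a<x | punchInℕ-above (≮⇒≥ b≮x) = m<n⇒m<1+n a<b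
... | no a≮x | yes b<x = ⊥-elim (a≮x (<-trans a<b b<x))
... | no a≮x | no b≮x rewrite punchInℕ-above (≮⇒≥ a≮x) | punchInℕ-above (≮⇒≥ b≮x) = s≤s a<b

punchInℕ-suc : ∀ x v → punchInℕ (suc x) (suc v) ≡ suc (punchInℕ x v)
punchInℕ-suc x v with v <? x
... | yes v<x rewrite punchInℕ-below v<x | punchInℕ-below (s≤s v<x) = refl
... | no v≮x rewrite punchInℕ-above (≮⇒≥ v≮x) | punchInℕ-above (s≤s (≮⇒≥ v≮x)) = refl

toℕ-punchIn : ∀ {n} (x : Fin (suc n)) (z : Fin n) → toℕ (punchIn x z) ≡ punchInℕ (toℕ x) (toℕ z)
toℕ-punchIn fz z = refl
toℕ-punchIn (fs x) fz = refl
toℕ-punchIn (fs x) (fs z) = trans (cong suc (toℕ-punchIn x z)) (sym (punchInℕ-suc (toℕ x) (toℕ z)))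

-- The letter of Fin (suc n) selected first by s_1 in any permutation: 0 for min, n for max.
extremeLetter : MinMax → (n : ℕ) → Fin (suc n)
extremeLetter min n = fz
extremeLetter max n = fromℕ n

extremeLetter-beats : ∀ m {n} (σ : Vec (Fin n) n) →
                      All (Beats m (toℕ (extremeLetter m n))) (map (punchInℕ (toℕ (extremeLetter m n))) (letters σ))
extremeLetter-beats min σ = All.map⁺ (All.tabulate (λ _ → s≤s z≤n))
extremeLetter-beats max {n} σ rewrite toℕ-fromℕ n =
  All.map⁺ (All.map (λ v<n → subst (_< n) (sym (punchInℕ-below v<n)) v<n) (letters-bounded σ))

other-beaten : ∀ m {n} (σ : Vec (Fin n) n) → distinct (letters σ) ≡ true → ∀ x → x ≢ extremeLetter m n →
               Any (λ b → Beats m b (toℕ x)) (map (punchInℕ (toℕ x)) (letters σ))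
other-beaten min σ d fz x≢0 = ⊥-elim (x≢0 refl)
other-beaten min {suc n} σ d (fs x) _ = Any.map⁺ (Any.map (λ { refl → s≤s z≤n }) (occurs σ d fz))
other-beaten max {n} σ d x x≢n = beaten n σ d (≤∧≢⇒< (s≤s⁻¹ (toℕ<n x)) (x≢n ∘ toℕ-injective ∘ flip trans (sym (toℕ-fromℕ n))))
  where
  beaten : ∀ n (σ : Vec (Fin n) n) → distinct (letters σ) ≡ true → toℕ x < n →
           Any (λ b → toℕ x < b) (map (punchInℕ (toℕ x)) (letters σ))
  beaten (suc n) σ d (s≤s x≤n) = Any.map⁺ (Any.map above-x (occurs σ d (fromℕ n)))
    where
    above-x : ∀ {v} → v ≡ toℕ (fromℕ n) → toℕ x < punchInℕ (toℕ x) v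
    above-x refl rewrite toℕ-fromℕ n | punchInℕ-above x≤n = s≤s x≤n

ms-extreme-first : ∀ s {n} (σ : Vec (Fin n) n) →
                   ms s (toℕ (extremeLetter (s 0) n) ∷ map (punchInℕ (toℕ (extremeLetter (s 0) n))) (letters σ))
                     ≡ suc (ms (shift s) (letters σ))
ms-extreme-first s {n} σ =
  trans (ms-head-selected s _ _ (extremeLetter-beats (s 0) σ)) (cong suc (Relabel.ms-map (punchInℕ e) (punchInℕ-mono e) (shift s) (letters σ)))
  where e = toℕ (extremeLetter (s 0) n)

ms-other-first : ∀ s {n} (σ : Vec (Fin n) n) → distinct (letters σ) ≡ true → ∀ x → x ≢ extremeLetter (s 0) n →
                 ms s (toℕ x ∷ map (punchInℕ (toℕ x)) (letters σ)) ≡ ms s (letters σ)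
ms-other-first s σ d x x≢e =
  trans (ms-head-skipped s _ _ (other-beaten (s 0) σ d x x≢e)) (Relabel.ms-map (punchInℕ (toℕ x)) (punchInℕ-mono (toℕ x)) s (letters σ))

msAfter : Seq → ∀ {n} → Fin (suc n) → Vec (Fin n) n → ℕ
msAfter s x σ = ms s (word (x V.∷ V.map (punchIn x) σ))

msAfter-letters : ∀ s {n} (x : Fin (suc n)) (σ : Vec (Fin n) n) →
                  msAfter s x σ ≡ ms s (toℕ x ∷ map (punchInℕ (toℕ x)) (letters σ))
msAfter-letters s x σ = cong (λ l → ms s (toℕ x ∷ l)) (letters-map (punchIn x) (punchInℕ (toℕ x)) (toℕ-punchIn x) σ)

-- The recurrence, by the first letter: it is s_1([n+1]) (one more selection, for the shifted
-- sequence) or one of the n other letters (m_s unchanged).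
countMs-recurrence : ∀ s n k →
  countMs s (suc n) k ≡ countWords n n (λ σ → isPerm σ ∧ (suc (ms (shift s) (word σ)) ≡ᵇ k)) + n * countMs s n k
countMs-recurrence s n k = begin
  countMs s (suc n) k
    ≡⟨ countWords-∷ (suc n) n (λ π → isPerm π ∧ (ms s (word π) ≡ᵇ k)) ⟩
  sum (λ x → countWords (suc n) n (λ w → isPerm (x V.∷ w) ∧ (ms s (word (x V.∷ w)) ≡ᵇ k)))
    ≡⟨ sum-cong-≗ {suc n} (λ x → perms-first-letter x (λ π → ms s (word π) ≡ᵇ k)) ⟩
  sum F
    ≡⟨ sum-except n e F (countMs s n k) (λ x x≢e → countWords-cong n n (λ σ → ∧-cong-if (λ d →
         cong (_≡ᵇ k) (trans (msAfter-letters s x σ) (ms-other-first s σ d x x≢e))))) ⟩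
  F e + n * countMs s n k
    ≡⟨ cong (_+ n * countMs s n k) (countWords-cong n n (λ σ →
         cong (λ v → isPerm σ ∧ (v ≡ᵇ k)) (trans (msAfter-letters s e σ) (ms-extreme-first s σ)))) ⟩
  countWords n n (λ σ → isPerm σ ∧ (suc (ms (shift s) (word σ)) ≡ᵇ k)) + n * countMs s n k
    ∎
  where
  open ≡-Reasoning
  e = extremeLetter (s 0) n
  F : Fin (suc n) → ℕ
  F x = countWords n n (λ σ → isPerm σ ∧ (msAfter s x σ ≡ᵇ k))

countMs-stirling : ∀ s n k → countMs s n k ≡ stirling n k
countMs-stirling s zero zero = refl
countMs-stirling s zero (suc k) = refl
countMs-stirling s (suc n) zero =
  trans (countMs-recurrence s n zero) (cong₂ _+_ (perms-suc≡0 n (ms (shift s) ∘ word)) (cong (n *_) (countMs-stirling s n zero)))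
countMs-stirling s (suc n) (suc k) =
  trans (countMs-recurrence s n (suc k)) (cong₂ _+_ (countMs-stirling (shift s) n k) (cong (n *_) (countMs-stirling s n (suc k))))

-- Cycle minima of a permutation.

IsCycleMin : ∀ {N} → Vec (Fin N) N → Fin N → Set
IsCycleMin π i = ∀ t → toℕ i ≤ toℕ (iter π t i)

iter-+ : ∀ {N} (π : Vec (Fin N) N) a d i → iter π (a + d) i ≡ iter π a (iter π d i)
iter-+ π zero d i = refl
iter-+ π (suc a) d i = cong (lookup π) (iter-+ π a d i)

iter-cancel : ∀ {N} (π : Vec (Fin N) N) → Injective _≡_ _≡_ (lookup π) → ∀ a {x y} → iter π a x ≡ iter π a y → x ≡ y
iter-cancel π inj zero e = e
iter-cancel π inj (suc a) e = iter-cancel π inj a (inj e)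

iter-period : ∀ {N} (π : Vec (Fin N) N) → Injective _≡_ _≡_ (lookup π) → ∀ i → ∃ λ p → 0 < p × p ≤ N × iter π p i ≡ i
iter-period {N} π inj i with pigeonhole (n<1+n N) (λ t → iter π (toℕ t) i)
... | a , b , a<b , e = toℕ b ∸ toℕ a , m<n⇒0<n∸m a<b , ≤-trans (m∸n≤m (toℕ b) (toℕ a)) (s≤s⁻¹ (toℕ<n b)) ,
      iter-cancel π inj (toℕ a) (sym (begin
        iter π (toℕ a) i                            ≡⟨ e ⟩
        iter π (toℕ b) i                            ≡⟨ cong (λ u → iter π u i) (m+[n∸m]≡n (<⇒≤ a<b)) ⟨
        iter π (toℕ a + (toℕ b ∸ toℕ a)) i          ≡⟨ iter-+ π (toℕ a) _ i ⟩
        iter π (toℕ a) (iter π (toℕ b ∸ toℕ a) i)   ∎))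
  where open ≡-Reasoning

iter-within-period : ∀ {N} (π : Vec (Fin N) N) i p → 0 < p → iter π p i ≡ i → ∀ t → ∃ λ r → r < p × iter π t i ≡ iter π r i
iter-within-period π i p 0<p e zero = 0 , 0<p , refl
iter-within-period π i p 0<p e (suc t) with iter-within-period π i p 0<p e t
... | r , r<p , e′ with m≤n⇒m<n∨m≡n r<p
... | inj₁ 1+r<p = suc r , 1+r<p , cong (lookup π) e′
... | inj₂ refl = 0 , 0<p , trans (cong (lookup π) e′) e

cycleMin-intro : ∀ {N} (π : Vec (Fin N) N) i → IsCycleMin π i → cycleMin π i ≡ true
cycleMin-intro {N} π i least = Equivalence.to T-≡ (All.all⁻ _ {upTo N} (All.tabulate (λ {j} _ → ≤⇒≤ᵇ (least (suc j)))))

cycleMin-elim : ∀ {N} (π : Vec (Fin N) N) → Injective _≡_ _≡_ (lookup π) → ∀ i → cycleMin π i ≡ true → IsCycleMin π i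
cycleMin-elim {N} π inj i isMin t with iter-period π inj i
... | p , 0<p , p≤N , back with iter-within-period π i p 0<p back t
...   | zero , _ , e = ≤-reflexive (cong toℕ (sym e))
...   | suc j , j<p , e = subst (toℕ i ≤_) (cong toℕ (sym e)) (≤ᵇ⇒≤ _ _ below)
  where
  below : T (toℕ i ≤ᵇ toℕ (iter π (suc j) i))
  below = All.lookup (All.all⁺ _ (upTo N) (Equivalence.from T-≡ isMin)) (∈-upTo⁺ (<-≤-trans (n<1+n j) (<⇒≤ (<-≤-trans j<p p≤N))))

cycles-sum : ∀ {N} (π : Vec (Fin N) N) → cycles π ≡ sum (𝟙 ∘ cycleMin π)
cycles-sum {N} π = count-tabulate (cycleMin π) N (λ i → i)

-- Inserting the largest element n into a permutation of [n].

-- `redirect y` enumerates the complement of y: z ↦ z, except that the letter at y itself is sent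
-- to the new largest letter n.
redirect : ∀ {n} → Fin (suc n) → Fin n → Fin (suc n)
redirect {suc n} fz fz = fromℕ (suc n)
redirect fz (fs z) = fs (inject₁ z)
redirect (fs y) fz = fz
redirect (fs y) (fs z) = fs (redirect y z)

redirect-cases : ∀ {n} (y : Fin (suc n)) (z : Fin n) →
                 (y ≡ inject₁ z × redirect y z ≡ fromℕ n) ⊎ (y ≢ inject₁ z × redirect y z ≡ inject₁ z)
redirect-cases fz fz = inj₁ (refl , refl)
redirect-cases fz (fs z) = inj₂ ((λ ()) , refl)
redirect-cases (fs y) fz = inj₂ ((λ ()) , refl)
redirect-cases (fs y) (fs z) with redirect-cases y z
... | inj₁ (y≡z , r) = inj₁ (cong fs y≡z , cong fs r)
... | inj₂ (y≢z , r) = inj₂ (y≢z ∘ fs-injective , cong fs r)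

sum-redirect : ∀ {n} (y : Fin (suc n)) (f : Fin (suc n) → ℕ) → sum f ≡ f y + sum (f ∘ redirect y)
sum-redirect {zero} fz f = refl
sum-redirect {suc n} fz f = cong (f fz +_) (trans (sum-init-last (f ∘ fs)) (+-comm _ (f (fs (fromℕ n)))))
sum-redirect {suc n} (fs y) f = trans (cong (f fz +_) (sum-redirect y (f ∘ fs))) (x∙yz≈y∙xz (f fz) (f (fs y)) _)

redirect-enumerates : ∀ {n} (y : Fin (suc n)) → Enumerates (redirect y) y
redirect-enumerates {n} y = record { misses = misses ; injective = injective ; sum-split = sum-redirect y }
  where
  misses : ∀ z → redirect y z ≢ y
  misses z e with redirect-cases y z
  ... | inj₁ (y≡z , r) = fromℕ≢inject₁ (trans (sym r) (trans e y≡z))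
  ... | inj₂ (y≢z , r) = y≢z (trans (sym e) r)
  injective : Injective _≡_ _≡_ (redirect y)
  injective {a} {b} e with redirect-cases y a | redirect-cases y b
  ... | inj₁ (y≡a , _) | inj₁ (y≡b , _) = inject₁-injective (trans (sym y≡a) y≡b)
  ... | inj₁ (_ , ra) | inj₂ (_ , rb) = ⊥-elim (fromℕ≢inject₁ (trans (sym ra) (trans e rb)))
  ... | inj₂ (_ , ra) | inj₁ (_ , rb) = ⊥-elim (fromℕ≢inject₁ (trans (sym rb) (trans (sym e) ra)))
  ... | inj₂ (_ , ra) | inj₂ (_ , rb) = inject₁-injective (trans (sym ra) (trans e rb))

lookup-∷ʳ-inject₁ : ∀ {A : Set} {n} (v : Vec A n) (y : A) i → lookup (v ∷ʳ y) (inject₁ i) ≡ lookup v i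
lookup-∷ʳ-inject₁ (x V.∷ v) y fz = refl
lookup-∷ʳ-inject₁ (x V.∷ v) y (fs i) = lookup-∷ʳ-inject₁ v y i

lookup-∷ʳ-last : ∀ {A : Set} {n} (v : Vec A n) (y : A) → lookup (v ∷ʳ y) (fromℕ n) ≡ y
lookup-∷ʳ-last V.[] y = refl
lookup-∷ʳ-last (x V.∷ v) y = lookup-∷ʳ-last v y

-- σ with the new largest letter n inserted: π(i) = redirect y (σ(i)) for i < n and π(n) = y.
-- So n is a fixed point when y = n, and otherwise n is inserted into the cycle of y, just before y.
insert : ∀ {n} → Vec (Fin n) n → Fin (suc n) → Vec (Fin (suc n)) (suc n)
insert σ y = V.map (redirect y) σ ∷ʳ y

module Insertion {n} (σ : Vec (Fin n) n) (y : Fin (suc n)) (σ-perm : isPerm σ ≡ true) where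

  π : Vec (Fin (suc n)) (suc n)
  π = insert σ y

  π-old : ∀ a → lookup π (inject₁ a) ≡ redirect y (lookup σ a)
  π-old a = trans (lookup-∷ʳ-inject₁ (V.map (redirect y) σ) y a) (lookup-map a (redirect y) σ)

  π-new : lookup π (fromℕ n) ≡ y
  π-new = lookup-∷ʳ-last (V.map (redirect y) σ) y

  π-perm : isPerm π ≡ true
  π-perm = begin
    distinct (letters π)
      ≡⟨ cong distinct (letters-∷ʳ (V.map (redirect y) σ) y) ⟩
    distinct (letters (V.map (redirect y) σ) ++ toℕ y ∷ [])
      ≡⟨ distinct-snoc (letters (V.map (redirect y) σ)) (toℕ y) ⟩
    fresh (toℕ y) (letters (V.map (redirect y) σ)) ∧ distinct (letters (V.map (redirect y) σ))
      ≡⟨ cong₂ _∧_ (fresh-map-missed (redirect y) y (Enumerates.misses enum) σ) (distinct-map (redirect y) (Enumerates.injective enum) σ) ⟩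
    distinct (letters σ)
      ≡⟨ σ-perm ⟩
    true ∎
    where
    open ≡-Reasoning
    enum = redirect-enumerates y

  π-injective : Injective _≡_ _≡_ (lookup π)
  π-injective = lookup-injective π π-perm

  orbit-forward : ∀ i t → (∃ λ t′ → iter π t (inject₁ i) ≡ inject₁ (iter σ t′ i))
                         ⊎ (iter π t (inject₁ i) ≡ fromℕ n × ∃ λ t′ → y ≡ inject₁ (iter σ t′ i))
  orbit-forward i zero = inj₁ (0 , refl)
  orbit-forward i (suc t) with orbit-forward i t
  ... | inj₁ (t′ , e) with redirect-cases y (lookup σ (iter σ t′ i))
  ...   | inj₁ (y≡ , r) = inj₂ (trans (cong (lookup π) e) (trans (π-old _) r) , suc t′ , y≡)
  ...   | inj₂ (_ , r) = inj₁ (suc t′ , trans (cong (lookup π) e) (trans (π-old _) r))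
  orbit-forward i (suc t) | inj₂ (e , t′ , y≡) = inj₁ (t′ , trans (cong (lookup π) e) (trans π-new y≡))

  orbit-backward : ∀ i t′ → ∃ λ t → iter π t (inject₁ i) ≡ inject₁ (iter σ t′ i)
  orbit-backward i zero = 0 , refl
  orbit-backward i (suc t′) with orbit-backward i t′
  ... | t , e with redirect-cases y (lookup σ (iter σ t′ i))
  ...   | inj₁ (y≡ , r) = suc (suc t) , trans (cong (lookup π) (trans (cong (lookup π) e) (trans (π-old _) r))) (trans π-new y≡)
  ...   | inj₂ (_ , r) = suc t , trans (cong (lookup π) e) (trans (π-old _) r)

  -- Hence old letters are cycle minima of π iff they are cycle minima of σ (n is larger than all).
  cycleMin-old : ∀ i → cycleMin π (inject₁ i) ≡ cycleMin σ i
  cycleMin-old i = ⇔→≡ (mk⇔ (λ c → cycleMin-intro σ i (to (cycleMin-elim π π-injective (inject₁ i) c)))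
                            (λ c → cycleMin-intro π (inject₁ i) (from (cycleMin-elim σ (lookup-injective σ σ-perm) i c))))
    where
    to : IsCycleMin π (inject₁ i) → IsCycleMin σ i
    to least t′ with orbit-backward i t′
    ... | t , e = subst₂ _≤_ (toℕ-inject₁ i) (trans (cong toℕ e) (toℕ-inject₁ _)) (least t)
    from : IsCycleMin σ i → IsCycleMin π (inject₁ i)
    from least t with orbit-forward i t
    ... | inj₁ (t′ , e) = subst₂ _≤_ (sym (toℕ-inject₁ i)) (sym (trans (cong toℕ e) (toℕ-inject₁ _))) (least t′)
    ... | inj₂ (e , _) = subst₂ _≤_ (sym (toℕ-inject₁ i)) (sym (trans (cong toℕ e) (toℕ-fromℕ n))) (<⇒≤ (toℕ<n i))

  cycles-insert : cycles π ≡ cycles σ + 𝟙 (cycleMin π (fromℕ n))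
  cycles-insert = begin
    cycles π                                                    ≡⟨ cycles-sum π ⟩
    sum (𝟙 ∘ cycleMin π)                                        ≡⟨ sum-init-last (𝟙 ∘ cycleMin π) ⟩
    sum (𝟙 ∘ cycleMin π ∘ inject₁) + 𝟙 (cycleMin π (fromℕ n))   ≡⟨ cong (_+ new) (sum-cong-≗ (cong 𝟙 ∘ cycleMin-old)) ⟩
    sum (𝟙 ∘ cycleMin σ) + 𝟙 (cycleMin π (fromℕ n))             ≡⟨ cong (_+ new) (cycles-sum σ) ⟨
    cycles σ + 𝟙 (cycleMin π (fromℕ n))                         ∎
    where
    open ≡-Reasoning
    new = 𝟙 (cycleMin π (fromℕ n))

  new-fixed : y ≡ fromℕ n → cycleMin π (fromℕ n) ≡ true
  new-fixed y≡n = cycleMin-intro π (fromℕ n) (λ t → ≤-reflexive (cong toℕ (sym (stays t))))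
    where
    stays : ∀ t → iter π t (fromℕ n) ≡ fromℕ n
    stays zero = refl
    stays (suc t) = trans (cong (lookup π) (stays t)) (trans π-new y≡n)

  new-inserted : ∀ y′ → y ≡ inject₁ y′ → cycleMin π (fromℕ n) ≡ false
  new-inserted y′ y≡ with cycleMin π (fromℕ n) in isMin
  ... | false = refl
  ... | true = ⊥-elim (<⇒≱ image<n (cycleMin-elim π π-injective (fromℕ n) isMin 1))
    where
    image<n : toℕ (lookup π (fromℕ n)) < toℕ (fromℕ n)
    image<n = subst₂ _<_ (sym (trans (cong toℕ (trans π-new y≡)) (toℕ-inject₁ y′))) (sym (toℕ-fromℕ n)) (toℕ<n y′)

-- The recurrence, by the last letter y: y = n makes n a new fixed point, any of the n other
-- choices inserts n into an existing cycle.
c-recurrence : ∀ n k → c (suc n) k ≡ countWords n n (λ σ → isPerm σ ∧ (suc (cycles σ) ≡ᵇ k)) + n * c n k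
c-recurrence n k = begin
  c (suc n) k
    ≡⟨ countWords-∷ʳ (suc n) n (λ π → isPerm π ∧ (cycles π ≡ᵇ k)) ⟩
  sum (λ y → countWords (suc n) n (λ w → isPerm (w ∷ʳ y) ∧ (cycles (w ∷ʳ y) ≡ᵇ k)))
    ≡⟨ sum-cong-≗ {suc n} (λ y → perms-last-letter (redirect-enumerates y) (λ π → cycles π ≡ᵇ k)) ⟩
  sum G
    ≡⟨ sum-except n (fromℕ n) G (c n k) inserted ⟩
  G (fromℕ n) + n * c n k
    ≡⟨ cong (_+ n * c n k) fixed ⟩
  countWords n n (λ σ → isPerm σ ∧ (suc (cycles σ) ≡ᵇ k)) + n * c n k
    ∎
  where
  open ≡-Reasoning
  G : Fin (suc n) → ℕ
  G y = countWords n n (λ σ → isPerm σ ∧ (cycles (insert σ y) ≡ᵇ k))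
  inserted : ∀ y → y ≢ fromℕ n → G y ≡ c n k
  inserted y y≢n with view y
  ... | ‵fromℕ = ⊥-elim (y≢n refl)
  ... | ‵inject₁ y′ = countWords-cong n n (λ σ → ∧-cong-if (λ d → cong (_≡ᵇ k) (begin
    cycles (insert σ y)                                     ≡⟨ Insertion.cycles-insert σ y d ⟩
    cycles σ + 𝟙 (cycleMin (insert σ y) (fromℕ n))          ≡⟨ cong (λ b → cycles σ + 𝟙 b) (Insertion.new-inserted σ y d y′ refl) ⟩
    cycles σ + 0                                            ≡⟨ +-identityʳ (cycles σ) ⟩
    cycles σ                                                ∎)))
  fixed : G (fromℕ n) ≡ countWords n n (λ σ → isPerm σ ∧ (suc (cycles σ) ≡ᵇ k))
  fixed = countWords-cong n n (λ σ → ∧-cong-if (λ d → cong (_≡ᵇ k) (begin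
    cycles (insert σ (fromℕ n))                             ≡⟨ Insertion.cycles-insert σ (fromℕ n) d ⟩
    cycles σ + 𝟙 (cycleMin (insert σ (fromℕ n)) (fromℕ n))  ≡⟨ cong (λ b → cycles σ + 𝟙 b) (Insertion.new-fixed σ (fromℕ n) d refl) ⟩
    cycles σ + 1                                            ≡⟨ +-comm (cycles σ) 1 ⟩
    suc (cycles σ)                                          ∎)))

c-stirling : ∀ n k → c n k ≡ stirling n k
c-stirling zero zero = refl
c-stirling zero (suc k) = refl
c-stirling (suc n) zero = trans (c-recurrence n zero) (cong₂ _+_ (perms-suc≡0 n cycles) (cong (n *_) (c-stirling n zero)))
c-stirling (suc n) (suc k) = trans (c-recurrence n (suc k)) (cong₂ _+_ (c-stirling n k) (cong (n *_) (c-stirling n (suc k))))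

-- The theorem.
mainTheorem18 : (s : Seq) (n k : ℕ) → 1 ≤ k → k ≤ n → countMs s n k ≡ c n k
mainTheorem18 s n k _ _ = trans (countMs-stirling s n k) (sym (c-stirling n k))
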